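{- Let $a_0\in\mathbb N$, $b\in\mathbb Z$ and $D\in\mathcal D$. Then: (1) every finite subset of $|\mathcal M|$ belongs to $\mathcal D$; (2) for every $a\in\mathbb N$ with $a\ge a_0$ there are integers $0\le b_1<\dots<b_i<2^a$ such that $M(2^{a_0},b)=M(2^a,b_1)\cup\dots\cup M(2^a,b_i)$; (3) there are $a\in\mathbb N$ and integers $0\le b_1<\dots<b_i<2^a$ such that $D\sim M(2^a,b_1)\cup\dots\cup M(2^a,b_i)$; (4) $\mu(D)$ exists and is a dyadic rational; (5) $D$ satisfies the induction schema for $N$, i.e. if $0_{\mathcal M}\in D$ and $s_{\mathcal M}(D)\subseteq D$ then $D=|\mathcal M|$; (6) $\mathcal D$ is closed under $\sim$, under complement in $|\mathcal M|$, and under finite unions.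
   Context: $|\mathcal M|=\{(1,n)\mid n\in\mathbb N\}\cup\{(2,z)\mid z\in\mathbb Z\}$, $0_{\mathcal M}=(1,0)$, $s_{\mathcal M}(i,y)=(i,y+1)$; write $(i,y)+n=(i,y+n)$ and $0_{\mathbb Z}=(2,0)$. For sets $I,J$: $I\sim J$ means $(I\setminus J)\cup(J\setminus I)$ is finite. For $r\in\mathbb N$, $s\in\mathbb Z$: $M(2^r,s)=\{0_{\mathcal M}+(2^rz+s)\mid z\in\mathbb Z,\ 2^rz+s\ge0\}\cup\{0_{\mathbb Z}+(2^rz+s)\mid z\in\mathbb Z\}$. $\mathcal B$ is the set of all $M(2^r,s)$ with $r\in\mathbb N,s\in\mathbb Z$, and $\mathcal D$ is the set of all $D\subseteq|\mathcal M|$ with $D\sim B_1\cup\dots\cup B_n$ for some $n\ge0$ and $B_1,\dots,B_n\in\mathcal B$. For $X\subseteq|\mathcal M|$, $\mu(X)=\lim_{x\to\infty}\frac{|\{(1,n),(2,-n),(2,n)\mid n\in[0,x]\cap\mathbb N\}\cap X|}{3(x+1)}$ when the limit exists. A dyadic rational is $z/2^m$ with $z\in\mathbb Z,m\in\mathbb N$. -}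

module Defs where

open import Data.Bool using (Bool; true; false; T; _∨_; _xor_; not; if_then_else_)
open import Data.Nat as ℕ using (ℕ; zero; suc; _^_)
import Data.Nat.Properties as ℕP
open import Data.Nat.Divisibility as ℕD using ()
open import Data.Integer as ℤ using (ℤ; +_; -_)
open import Data.Rational as ℚ using (ℚ; 0ℚ; 1ℚ; _÷_)
import Data.Rational.Properties as ℚP
open import Data.Sum using (_⊎_; inj₁; inj₂)
open import Data.Product using (Σ; ∃; _×_; _,_)
open import Data.List using (List; []; _∷_; foldr; map)
open import Data.List.Membership.Propositional using (_∈_)
open import Relation.Nullary.Decidable using (⌊_⌋)
open import Relation.Binary.PropositionalEquality using (_≡_)

-- |M| : (1,n) is inj₁ n, (2,z) is inj₂ z
Carrier : Set
Carrier = ℕ ⊎ ℤ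

0M : Carrier
0M = inj₁ 0

sM : Carrier → Carrier
sM (inj₁ n) = inj₁ (suc n)
sM (inj₂ z) = inj₂ (z ℤ.+ + 1)

Subset : Set
Subset = Carrier → Bool

_∈ₛ_ : Carrier → Subset → Set
x ∈ₛ X = T (X x)

_≐_ : Subset → Subset → Set
X ≐ Y = ∀ x → X x ≡ Y x

Full : Subset
Full _ = true

compl : Subset → Subset
compl X x = not (X x)

Finite : Subset → Set
Finite X = Σ (List Carrier) λ L → ∀ x → x ∈ₛ X → x ∈ L

symDiff : Subset → Subset → Subset
symDiff X Y x = X x xor Y x

_∼_ : Subset → Subset → Set
X ∼ Y = Finite (symDiff X Y)

⋃ : List Subset → Subset
⋃ Xs x = foldr (λ X b → X x ∨ b) false Xs

-- M(m, s) = {0_M + (m z + s) | m z + s ≥ 0} ∪ {0_Z + (m z + s)}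
-- i.e. y belongs iff y = m z + s for some integer z, i.e. m ∣ y - s
Mset : ℕ → ℤ → Subset
Mset m s (inj₁ n) = ⌊ m ℕD.∣? ℤ.∣ + n ℤ.- s ∣ ⌋
Mset m s (inj₂ z) = ⌊ m ℕD.∣? ℤ.∣ z ℤ.- s ∣ ⌋

InD : Subset → Set
InD D = Σ (List (ℕ × ℤ)) λ rs →
  D ∼ ⋃ (map (λ { (r , s) → Mset (2 ^ r) s }) rs)

data Increasing : List ℤ → Set where
  inc[] : Increasing []
  inc[_] : ∀ b → Increasing (b ∷ [])
  inc∷ : ∀ {b c bs} → b ℤ.< c → Increasing (c ∷ bs) → Increasing (b ∷ c ∷ bs)

data AllIn (a : ℕ) : List ℤ → Set where
  all[] : AllIn a []
  all∷ : ∀ {b bs} → + 0 ℤ.≤ b → b ℤ.< + (2 ^ a) → AllIn a bs → AllIn a (b ∷ bs)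

χ : Bool → ℕ
χ true = 1
χ false = 0

-- |{(1,n),(2,-n),(2,n) | n ∈ [0,x] ∩ ℕ} ∩ X|  (note (2,-0) = (2,0) is counted once)
windowCount : Subset → ℕ → ℕ
windowCount X zero = χ (X (inj₁ 0)) ℕ.+ χ (X (inj₂ (+ 0)))
windowCount X (suc n) = windowCount X n ℕ.+
  (χ (X (inj₁ (suc n))) ℕ.+ χ (X (inj₂ (- + suc n))) ℕ.+ χ (X (inj₂ (+ suc n))))

denom : ℚ → ℚ
denom x = (+ 3 ℚ./ 1) ℚ.* (x ℚ.+ 1ℚ)

denom-nonZero : ∀ x → 0ℚ ℚ.≤ x → ℚ.NonZero (denom x)
denom-nonZero x h =
  let instance _ = ℚ.nonNegative h
      instance p1 = ℚP.nonNeg+pos⇒pos x 1ℚ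
      instance _ = ℚP.pos*pos⇒pos (+ 3 ℚ./ 1) (x ℚ.+ 1ℚ)
  in ℚP.pos⇒nonZero (denom x)

-- the ratio |…∩X| / (3(x+1)) for a real (here: rational) x ≥ 0; [0,x] ∩ ℕ = {0,…,⌊x⌋}
ratio : Subset → (x : ℚ) → 0ℚ ℚ.≤ x → ℚ
ratio X x h = (_÷_ (+ windowCount X ℤ.∣ ℚ.floor x ∣ ℚ./ 1) (denom x)) {{denom-nonZero x h}}

HasDensity : Subset → ℚ → Set
HasDensity X q = ∀ (ε : ℚ) → 0ℚ ℚ.< ε → Σ ℕ λ N → ∀ (x : ℚ) (h : 0ℚ ℚ.≤ x) →
  (+ N ℚ./ 1) ℚ.≤ x → ℚ.∣ ratio X x h ℚ.- q ∣ ℚ.< ε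

Dyadic : ℚ → Set
Dyadic q = Σ ℤ λ z → Σ ℕ λ m → q ≡ (z ℚ./ (2 ^ m)) {{ℕP.m^n≢0 2 m}}

module Submission where

-- Identify (1,n) with (2,n) via ι : |M| → ℤ. Each M(2^r,s) is then the pullback of a residue
-- class of ℤ, so every D ∈ 𝒟 agrees, outside finitely many points, with h ∘ ι for a 2^a-periodic
-- h : ℤ → Bool; conversely such sets lie in 𝒟, which gives the closure properties. A 2^a-periodic h
-- is the union of the classes M(2^a,b) over the residues b where it holds, giving (2) and (3).
-- For (5), D contains every (1,n), so h holds on all large naturals and by periodicity everywhere;
-- hence D contains (2,w) for w arbitrarily negative, and closure under s_M climbs to every (2,z).
-- For (4), h holds at exactly k points of every period, so up to a bounded error the window count
-- of D is 3k(n+1)/2^a, and μ(D) = k/2^a.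

open import Defs
open import Data.Bool using (Bool; true; false; T; _∨_; _xor_; not; if_then_else_)
open import Data.Bool.Properties using (xor-comm; xor-same; xor-identityʳ; not-involutive; ∨-assoc; T-≡)
open import Data.Empty using (⊥-elim)
open import Data.Unit using (tt)
open import Data.Nat as ℕ using (ℕ; zero; suc; _^_; _⊔_; _≥_)
import Data.Nat.Properties as ℕP
import Data.Nat.Divisibility as ℕD
open import Data.Nat.DivMod using (m/n*n≤m; m≡m%n+[m/n]*n; m%n<n)
import Data.Nat.Tactic.RingSolver as ℕ-Ring
open import Data.Integer as ℤ using (ℤ; +_; -[1+_])
import Data.Integer.Properties as ℤP
open import Data.Integer.DivMod using (_%ℕ_; _/ℕ_; n%ℕd<d; a≡a%ℕn+[a/ℕn]*n; div-pos-is-/ℕ)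
import Data.Integer.Divisibility.Signed as ℤD
import Data.Integer.Tactic.RingSolver as ℤ-Ring
open import Data.Rational as ℚ using (ℚ; mkℚ; _/_; 0ℚ; 1ℚ; toℚᵘ)
import Data.Rational.Properties as ℚP
import Data.Rational.Unnormalised as ℚᵘ
import Data.Rational.Unnormalised.Properties as ℚᵘP
open import Data.Sum using (_⊎_; inj₁; inj₂; [_,_])
open import Data.Product using (Σ; _×_; _,_; proj₁; proj₂)
open import Data.List using (List; []; _∷_; foldr; map; _++_)
open import Data.List.Properties using (map-++; map-∘)
open import Data.List.Membership.Propositional using (_∈_)
open import Data.List.Membership.Propositional.Properties using (∈-++⁺ˡ; ∈-++⁺ʳ)
open import Data.List.Relation.Unary.All as All using (All; []; _∷_)
open import Data.List.Relation.Unary.Any using (here; there)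
open import Function using (_∘_)
open import Function.Bundles using (Equivalence; mk⇔)
open import Relation.Nullary using (Dec; ¬_)
open import Relation.Nullary.Decidable using (⌊_⌋; isYes≗does; dec-true; dec-false; does-⇔)
open import Relation.Nullary.Decidable.Core using (dec⇒maybe)
open import Relation.Binary.PropositionalEquality hiding ([_])
import Tactic.RingSolver.Core.AlmostCommutativeRing as ACR

Finite-⊆ : ∀ {X Y} → (∀ x → x ∈ₛ Y → x ∈ₛ X) → Finite X → Finite Y
Finite-⊆ Y⊆X (L , X⊆L) = L , λ x y → X⊆L x (Y⊆X x y)

Finite-⊆∪ : ∀ {X Y Z} → (∀ x → x ∈ₛ Z → x ∈ₛ X ⊎ x ∈ₛ Y) →
            Finite X → Finite Y → Finite Z
Finite-⊆∪ Z⊆X∪Y (L , X⊆L) (L′ , Y⊆L′) = L ++ L′ , λ x z →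
  [ (λ u → ∈-++⁺ˡ (X⊆L x u)) , (λ u → ∈-++⁺ʳ L (Y⊆L′ x u)) ] (Z⊆X∪Y x z)

xor-split : ∀ a b c → T (a xor c) → T (a xor b) ⊎ T (b xor c)
xor-split true  true  c t = inj₂ t
xor-split false false c t = inj₂ t
xor-split true  false c t = inj₁ tt
xor-split false true  c t = inj₁ tt

xor-not : ∀ a b → T (not a xor not b) → T (a xor b)
xor-not true  b t = t
xor-not false b t = subst T (not-involutive b) t

xor-∨ : ∀ a b c d → T ((a ∨ b) xor (c ∨ d)) → T (a xor c) ⊎ T (b xor d)
xor-∨ true  b false d t = inj₁ tt
xor-∨ false b true  d t = inj₁ tt
xor-∨ false b false d t = inj₂ t

≐⇒∼ : ∀ {X Y} → X ≐ Y → X ∼ Y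
≐⇒∼ {X} {Y} X≐Y = [] , λ x t →
  ⊥-elim (subst T (trans (cong (_xor Y x) (X≐Y x)) (xor-same (Y x))) t)

∼-sym : ∀ {X Y} → X ∼ Y → Y ∼ X
∼-sym {X} {Y} = Finite-⊆ λ x → subst T (xor-comm (Y x) (X x))

∼-trans : ∀ {X Y Z} → X ∼ Y → Y ∼ Z → X ∼ Z
∼-trans {X} {Y} {Z} = Finite-⊆∪ λ x → xor-split (X x) (Y x) (Z x)

∼-≐-trans : ∀ {X Y Z} → X ∼ Y → Y ≐ Z → X ∼ Z
∼-≐-trans {X} {Y} {Z} X∼Y Y≐Z = ∼-trans {X} {Y} {Z} X∼Y (≐⇒∼ {Y} {Z} Y≐Z)

∼-compl : ∀ {X Y} → X ∼ Y → compl X ∼ compl Y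
∼-compl {X} {Y} = Finite-⊆ λ x → xor-not (X x) (Y x)

∼-∪ : ∀ {X Y X′ Y′} → X ∼ Y → X′ ∼ Y′ → (λ x → X x ∨ X′ x) ∼ (λ x → Y x ∨ Y′ x)
∼-∪ {X} {Y} {X′} {Y′} = Finite-⊆∪ λ x → xor-∨ (X x) (X′ x) (Y x) (Y′ x)

Finite⇒∼⋃[] : ∀ {X} → Finite X → X ∼ ⋃ []
Finite⇒∼⋃[] {X} = Finite-⊆ λ x → subst T (xor-identityʳ (X x))

⋃-++ : ∀ Xs Ys → ⋃ (Xs ++ Ys) ≐ (λ x → ⋃ Xs x ∨ ⋃ Ys x)
⋃-++ []       Ys x = refl
⋃-++ (X ∷ Xs) Ys x = trans (cong (X x ∨_) (⋃-++ Xs Ys x)) (sym (∨-assoc (X x) _ _))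

ι : Carrier → ℤ
ι (inj₁ n) = + n
ι (inj₂ z) = z

Mℤ : ℕ → ℤ → ℤ → Bool
Mℤ m s z = ⌊ m ℕD.∣? ℤ.∣ z ℤ.- s ∣ ⌋

Mset≡Mℤ∘ι : ∀ m s x → Mset m s x ≡ Mℤ m s (ι x)
Mset≡Mℤ∘ι m s (inj₁ n) = refl
Mset≡Mℤ∘ι m s (inj₂ z) = refl

⋃ℤ : List (ℤ → Bool) → ℤ → Bool
⋃ℤ hs z = foldr (λ h b → h z ∨ b) false hs

⋃-∘ι : {A : Set} (F : A → Subset) (G : A → ℤ → Bool) → (∀ a x → F a x ≡ G a (ι x)) →
       ∀ as x → ⋃ (map F as) x ≡ ⋃ℤ (map G as) (ι x)
⋃-∘ι F G F≡G∘ι []       x = refl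
⋃-∘ι F G F≡G∘ι (a ∷ as) x = cong₂ _∨_ (F≡G∘ι a x) (⋃-∘ι F G F≡G∘ι as x)

⋃-Mset : ∀ m bs x → ⋃ (map (Mset m) bs) x ≡ ⋃ℤ (map (Mℤ m) bs) (ι x)
⋃-Mset m = ⋃-∘ι (Mset m) (Mℤ m) (Mset≡Mℤ∘ι m)

⌊⌋-true : ∀ {P : Set} (p? : Dec P) → P → ⌊ p? ⌋ ≡ true
⌊⌋-true p? p = trans (isYes≗does p?) (dec-true p? p)

⌊⌋-false : ∀ {P : Set} (p? : Dec P) → ¬ P → ⌊ p? ⌋ ≡ false
⌊⌋-false p? ¬p = trans (isYes≗does p?) (dec-false p? ¬p)

⌊⌋-⇔ : ∀ {P Q : Set} (p? : Dec P) (q? : Dec Q) → (P → Q) → (Q → P) → ⌊ p? ⌋ ≡ ⌊ q? ⌋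
⌊⌋-⇔ p? q? P→Q Q→P =
  trans (isYes≗does p?) (trans (does-⇔ (mk⇔ P→Q Q→P) p? q?) (sym (isYes≗does q?)))

Periodic : ℕ → (ℤ → Bool) → Set
Periodic p h = ∀ z → h (z ℤ.+ + p) ≡ h z

i+∣j-i∣≡j : ∀ {i j} → i ℤ.≤ j → i ℤ.+ + ℤ.∣ j ℤ.- i ∣ ≡ j
i+∣j-i∣≡j {i} {j} i≤j = begin
  i ℤ.+ + ℤ.∣ j ℤ.- i ∣ ≡⟨ cong (λ n → i ℤ.+ + n) (ℤP.∣i-j∣≡∣j-i∣ j i) ⟩
  i ℤ.+ + ℤ.∣ i ℤ.- j ∣ ≡⟨ cong (λ w → i ℤ.+ w) (ℤP.∣-∣-≤ i≤j) ⟩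
  i ℤ.+ (j ℤ.- i)       ≡⟨ add-sub i j ⟩
  j                     ∎
  where
  open ≡-Reasoning
  add-sub : ∀ i j → i ℤ.+ (j ℤ.- i) ≡ j
  add-sub = ℤ-Ring.solve-∀

module _ {p : ℕ} {h : ℤ → Bool} (per : Periodic p h) where

  periodic-+-multiple : ∀ n z → h (z ℤ.+ + (n ℕ.* p)) ≡ h z
  periodic-+-multiple zero    z = cong h (ℤP.+-identityʳ z)
  periodic-+-multiple (suc n) z = begin
    h (z ℤ.+ + (p ℕ.+ n ℕ.* p))      ≡⟨ cong (λ w → h (z ℤ.+ w)) (ℤP.pos-+ p (n ℕ.* p)) ⟩
    h (z ℤ.+ (+ p ℤ.+ + (n ℕ.* p)))  ≡⟨ cong h (sym (ℤP.+-assoc z (+ p) _)) ⟩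
    h (z ℤ.+ + p ℤ.+ + (n ℕ.* p))    ≡⟨ periodic-+-multiple n (z ℤ.+ + p) ⟩
    h (z ℤ.+ + p)                    ≡⟨ per z ⟩
    h z                              ∎
    where open ≡-Reasoning

  private
    periodic-≤-∣ : ∀ {z s} → s ℤ.≤ z → p ℕD.∣ ℤ.∣ z ℤ.- s ∣ → h z ≡ h s
    periodic-≤-∣ {z} {s} s≤z (ℕD.divides n ∣z-s∣≡np) = begin
      h z                          ≡⟨ cong h (sym (i+∣j-i∣≡j s≤z)) ⟩
      h (s ℤ.+ + ℤ.∣ z ℤ.- s ∣)    ≡⟨ cong (λ m → h (s ℤ.+ + m)) ∣z-s∣≡np ⟩
      h (s ℤ.+ + (n ℕ.* p))        ≡⟨ periodic-+-multiple n s ⟩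
      h s                          ∎
      where open ≡-Reasoning

  periodic-∣ : ∀ {z s} → p ℕD.∣ ℤ.∣ z ℤ.- s ∣ → h z ≡ h s
  periodic-∣ {z} {s} p∣z-s with ℤP.≤-total s z
  ... | inj₁ s≤z = periodic-≤-∣ s≤z p∣z-s
  ... | inj₂ z≤s = sym (periodic-≤-∣ z≤s (subst (p ℕD.∣_) (ℤP.∣i-j∣≡∣j-i∣ z s) p∣z-s))

periodic-∨ : ∀ {p g h} → Periodic p g → Periodic p h → Periodic p (λ z → g z ∨ h z)
periodic-∨ per-g per-h z = cong₂ _∨_ (per-g z) (per-h z)

Mℤ-periodic : ∀ {m p} s → m ℕD.∣ p → Periodic p (Mℤ m s)
Mℤ-periodic {m} {p} s m∣p z = ⌊⌋-⇔ _ _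
  (λ d → ℤD.∣⇒∣ᵤ (ℤD.∣m+n∣n⇒∣m {m = z ℤ.- s} (subst (ℤD._∣_ (+ m)) (shift z) (ℤD.∣ᵤ⇒∣ d)) m∣p′))
  (λ d → ℤD.∣⇒∣ᵤ (subst (ℤD._∣_ (+ m)) (sym (shift z)) (ℤD.∣m∣n⇒∣m+n (ℤD.∣ᵤ⇒∣ {i = z ℤ.- s} d) m∣p′)))
  where
  m∣p′ : + m ℤD.∣ + p
  m∣p′ = ℤD.∣ᵤ⇒∣ m∣p
  shift : ∀ z → (z ℤ.+ + p) ℤ.- s ≡ (z ℤ.- s) ℤ.+ + p
  shift z = reorder z (+ p) s
    where
    reorder : ∀ z p s → (z ℤ.+ p) ℤ.- s ≡ (z ℤ.- s) ℤ.+ p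
    reorder = ℤ-Ring.solve-∀

^-monoʳ-∣ : ∀ m {r a} → r ℕ.≤ a → m ^ r ℕD.∣ m ^ a
^-monoʳ-∣ m {r} {a} r≤a = subst (λ t → m ^ r ℕD.∣ m ^ t) (ℕP.m+[n∸m]≡n r≤a)
  (subst (m ^ r ℕD.∣_) (sym (ℕP.^-distribˡ-+-* m r (a ℕ.∸ r))) (ℕD.m∣m*n (m ^ (a ℕ.∸ r))))

m∣n∧n<m⇒n≡0 : ∀ {m n} → m ℕD.∣ n → n ℕ.< m → n ≡ 0
m∣n∧n<m⇒n≡0 {n = zero}  _   _   = refl
m∣n∧n<m⇒n≡0 {n = suc _} m∣n n<m = ⊥-elim (ℕD.>⇒∤ n<m m∣n)

residue-unique : ∀ {p r b} → r ℕ.< p → b ℕ.< p → p ℕD.∣ ℤ.∣ + r ℤ.- + b ∣ → r ≡ b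
residue-unique {p} {r} {b} r<p b<p p∣r-b =
  ℤP.+-injective (ℤP.i-j≡0⇒i≡j (+ r) (+ b) (ℤP.∣i∣≡0⇒i≡0 (m∣n∧n<m⇒n≡0 p∣r-b ∣r-b∣<p)))
  where
  ∣r-b∣<p : ℤ.∣ + r ℤ.- + b ∣ ℕ.< p
  ∣r-b∣<p = subst (ℕ._< p) (cong ℤ.∣_∣ (sym (ℤP.m-n≡m⊖n r b)))
    (ℕP.≤-<-trans (ℤP.∣m⊝n∣≤m⊔n r b) (ℕP.⊔-pres-<m r<p b<p))

module _ (p : ℕ) .{{_ : ℕ.NonZero p}} (z : ℤ) where

  p∣z-z%p : p ℕD.∣ ℤ.∣ z ℤ.- + (z %ℕ p) ∣
  p∣z-z%p = ℤD.∣⇒∣ᵤ (ℤD.divides (z /ℕ p) (cancel z (+ (z %ℕ p)) (z /ℕ p) (+ p) (a≡a%ℕn+[a/ℕn]*n z p)))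
    where
    cancel : ∀ z r q p → z ≡ r ℤ.+ q ℤ.* p → z ℤ.- r ≡ q ℤ.* p
    cancel z r q p refl = sub-add r q p
      where
      sub-add : ∀ r q p → (r ℤ.+ q ℤ.* p) ℤ.- r ≡ q ℤ.* p
      sub-add = ℤ-Ring.solve-∀

  Mℤ-residue : Mℤ p (+ (z %ℕ p)) z ≡ true
  Mℤ-residue = ⌊⌋-true _ p∣z-z%p

  Mℤ-nonresidue : ∀ b → b ℕ.< p → b ≢ z %ℕ p → Mℤ p (+ b) z ≡ false
  Mℤ-nonresidue b b<p b≢r = ⌊⌋-false _ λ p∣z-b →
    b≢r (sym (residue-unique (n%ℕd<d z p) b<p (p∣r-b p∣z-b)))
    where
    r = z %ℕ p
    difference : ∀ z b r → (z ℤ.- b) ℤ.- (z ℤ.- r) ≡ r ℤ.- b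
    difference = ℤ-Ring.solve-∀
    p∣r-b : p ℕD.∣ ℤ.∣ z ℤ.- + b ∣ → p ℕD.∣ ℤ.∣ + r ℤ.- + b ∣
    p∣r-b p∣z-b = ℤD.∣⇒∣ᵤ (subst (ℤD._∣_ (+ p)) (difference z (+ b) (+ r))
      (ℤD.∣m∣n⇒∣m-n (ℤD.∣ᵤ⇒∣ {i = z ℤ.- + b} p∣z-b) (ℤD.∣ᵤ⇒∣ {i = z ℤ.- + r} p∣z-z%p)))

residuesFrom : (ℤ → Bool) → ℕ → ℕ → List ℤ
residuesFrom h s zero    = []
residuesFrom h s (suc l) =
  if h (+ s) then + s ∷ residuesFrom h (suc s) l else residuesFrom h (suc s) l

residues : ℕ → (ℤ → Bool) → List ℤ
residues p h = residuesFrom h 0 p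

module _ (p : ℕ) .{{_ : ℕ.NonZero p}} (h : ℤ → Bool) (z : ℤ) where

  private
    r = z %ℕ p

    ⋃ℤ-Mℤ : List ℤ → Bool
    ⋃ℤ-Mℤ bs = ⋃ℤ (map (Mℤ p) bs) z

    tail≤ : ∀ {s l} → s ℕ.+ suc l ℕ.≤ p → suc s ℕ.+ l ℕ.≤ p
    tail≤ {s} {l} = subst (ℕ._≤ p) (ℕP.+-suc s l)

    head< : ∀ {s l} → s ℕ.+ suc l ℕ.≤ p → s ℕ.< p
    head< {s} = ℕP.<-≤-trans (ℕP.m<m+n s (ℕ.s≤s ℕ.z≤n))

  ⋃ℤ-residuesFrom-above : ∀ s l → r ℕ.< s → s ℕ.+ l ℕ.≤ p →
                          ⋃ℤ-Mℤ (residuesFrom h s l) ≡ false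
  ⋃ℤ-residuesFrom-above s zero    r<s _   = refl
  ⋃ℤ-residuesFrom-above s (suc l) r<s s+l≤p with h (+ s)
  ... | true  = cong₂ _∨_ (Mℤ-nonresidue p z s (head< s+l≤p) λ s≡r → ℕP.<-irrefl (sym s≡r) r<s)
                          (⋃ℤ-residuesFrom-above (suc s) l (ℕP.m<n⇒m<1+n r<s) (tail≤ s+l≤p))
  ... | false = ⋃ℤ-residuesFrom-above (suc s) l (ℕP.m<n⇒m<1+n r<s) (tail≤ s+l≤p)

  ⋃ℤ-residuesFrom-∋ : ∀ s l → s ℕ.≤ r → r ℕ.< s ℕ.+ l → s ℕ.+ l ℕ.≤ p →
                      ⋃ℤ-Mℤ (residuesFrom h s l) ≡ h (+ r)
  ⋃ℤ-residuesFrom-∋ s zero s≤r r<s+0 _ =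
    ⊥-elim (ℕP.<-irrefl refl (ℕP.≤-<-trans s≤r (subst (r ℕ.<_) (ℕP.+-identityʳ s) r<s+0)))
  ⋃ℤ-residuesFrom-∋ s (suc l) s≤r r<s+l s+l≤p with ℕP.m≤n⇒m<n∨m≡n s≤r
  ... | inj₂ refl with h (+ s)
  ...   | true  = cong (_∨ ⋃ℤ-Mℤ (residuesFrom h (suc s) l)) (Mℤ-residue p z)
  ...   | false = ⋃ℤ-residuesFrom-above (suc s) l ℕP.≤-refl (tail≤ s+l≤p)
  ⋃ℤ-residuesFrom-∋ s (suc l) s≤r r<s+l s+l≤p | inj₁ s<r with h (+ s)
  ... | true  = cong₂ _∨_ (Mℤ-nonresidue p z s (head< s+l≤p) λ s≡r → ℕP.<-irrefl s≡r s<r) rest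
    where
    rest = ⋃ℤ-residuesFrom-∋ (suc s) l s<r (subst (r ℕ.<_) (ℕP.+-suc s l) r<s+l) (tail≤ s+l≤p)
  ... | false = ⋃ℤ-residuesFrom-∋ (suc s) l s<r (subst (r ℕ.<_) (ℕP.+-suc s l) r<s+l) (tail≤ s+l≤p)

periodic-normalForm : ∀ {p h} .{{_ : ℕ.NonZero p}} → Periodic p h →
                      ∀ z → h z ≡ ⋃ℤ (map (Mℤ p) (residues p h)) z
periodic-normalForm {p} {h} per z = trans (periodic-∣ per (p∣z-z%p p z))
  (sym (⋃ℤ-residuesFrom-∋ p h z 0 p ℕ.z≤n (n%ℕd<d z p) ℕP.≤-refl))

residuesFrom-≥ : ∀ h s l → All (+ s ℤ.≤_) (residuesFrom h s l)
residuesFrom-≥ h s zero    = []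
residuesFrom-≥ h s (suc l) with h (+ s)
... | true  = ℤP.≤-refl ∷ All.map (ℤP.≤-trans (ℤ.+≤+ (ℕP.n≤1+n s))) (residuesFrom-≥ h (suc s) l)
... | false = All.map (ℤP.≤-trans (ℤ.+≤+ (ℕP.n≤1+n s))) (residuesFrom-≥ h (suc s) l)

residuesFrom-increasing : ∀ h s l → Increasing (residuesFrom h s l)
residuesFrom-increasing h s zero    = inc[]
residuesFrom-increasing h s (suc l) with h (+ s)
... | true  = cons (residuesFrom-increasing h (suc s) l)
                   (All.map (ℤP.<-≤-trans (ℤ.+<+ (ℕP.n<1+n s))) (residuesFrom-≥ h (suc s) l))
  where
  cons : ∀ {b bs} → Increasing bs → All (b ℤ.<_) bs → Increasing (b ∷ bs)
  cons {b} inc[]          []      = inc[ b ]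
  cons     inc[ _ ]       (b<c ∷ _) = inc∷ b<c inc[ _ ]
  cons     (inc∷ c<d inc) (b<c ∷ _) = inc∷ b<c (inc∷ c<d inc)
... | false = residuesFrom-increasing h (suc s) l

residuesFrom-allIn : ∀ a h s l → s ℕ.+ l ℕ.≤ 2 ^ a → AllIn a (residuesFrom h s l)
residuesFrom-allIn a h s zero    _     = all[]
residuesFrom-allIn a h s (suc l) s+l≤p with h (+ s)
... | true  = all∷ (ℤ.+≤+ ℕ.z≤n) (ℤ.+<+ (ℕP.<-≤-trans (ℕP.m<m+n s (ℕ.s≤s ℕ.z≤n)) s+l≤p))
                   (residuesFrom-allIn a h (suc s) l (subst (ℕ._≤ 2 ^ a) (ℕP.+-suc s l) s+l≤p))
... | false = residuesFrom-allIn a h (suc s) l (subst (ℕ._≤ 2 ^ a) (ℕP.+-suc s l) s+l≤p)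

record AlmostPeriodic (D : Subset) : Set where
  constructor almostPeriodic
  field
    exponent : ℕ
    profile  : ℤ → Bool
    periodic : Periodic (2 ^ exponent) profile
    almost   : D ∼ (profile ∘ ι)

Mℤ-pair : ℕ × ℤ → ℤ → Bool
Mℤ-pair (r , s) = Mℤ (2 ^ r) s

maxExponent : List (ℕ × ℤ) → ℕ
maxExponent []             = 0
maxExponent ((r , _) ∷ rs) = r ⊔ maxExponent rs

⋃ℤ-Mℤ-pair-periodic : ∀ rs {a} → maxExponent rs ℕ.≤ a → Periodic (2 ^ a) (⋃ℤ (map Mℤ-pair rs))
⋃ℤ-Mℤ-pair-periodic []             _  z = refl
⋃ℤ-Mℤ-pair-periodic ((r , s) ∷ rs) le = periodic-∨
  (Mℤ-periodic s (^-monoʳ-∣ 2 (ℕP.≤-trans (ℕP.m≤m⊔n r (maxExponent rs)) le)))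
  (⋃ℤ-Mℤ-pair-periodic rs (ℕP.≤-trans (ℕP.m≤n⊔m r (maxExponent rs)) le))

InD⇒AlmostPeriodic : ∀ {D} → InD D → AlmostPeriodic D
InD⇒AlmostPeriodic {D} (rs , D∼⋃) = almostPeriodic (maxExponent rs) (⋃ℤ (map Mℤ-pair rs))
  (⋃ℤ-Mℤ-pair-periodic rs ℕP.≤-refl)
  (∼-≐-trans {D} D∼⋃ (⋃-∘ι _ Mℤ-pair (λ { (r , s) → Mset≡Mℤ∘ι (2 ^ r) s }) rs))

periodic-Mset-normalForm : ∀ a {h} → Periodic (2 ^ a) h →
  Σ (List ℤ) λ bs → Increasing bs × AllIn a bs × ((h ∘ ι) ≐ ⋃ (map (Mset (2 ^ a)) bs))
periodic-Mset-normalForm a {h} per =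
  residues (2 ^ a) h , residuesFrom-increasing h 0 (2 ^ a) , residuesFrom-allIn a h 0 (2 ^ a) ℕP.≤-refl ,
  λ x → trans (periodic-normalForm per (ι x)) (sym (⋃-Mset (2 ^ a) (residues (2 ^ a) h) x))
  where instance _ = ℕP.m^n≢0 2 a

module _ {D : Subset} (ap : AlmostPeriodic D) where
  open AlmostPeriodic ap

  AlmostPeriodic⇒Mset-normalForm : Σ ℕ λ a → Σ (List ℤ) λ bs → Increasing bs × AllIn a bs
                                     × (D ∼ ⋃ (map (Mset (2 ^ a)) bs))
  AlmostPeriodic⇒Mset-normalForm with periodic-Mset-normalForm exponent periodic
  ... | bs , inc , allIn , h∘ι≐⋃ = exponent , bs , inc , allIn , ∼-≐-trans {D} almost h∘ι≐⋃

  AlmostPeriodic⇒InD : InD D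
  AlmostPeriodic⇒InD with periodic-Mset-normalForm exponent periodic
  ... | bs , _ , _ , h∘ι≐⋃ = map (exponent ,_) bs , ∼-≐-trans {D} almost
    (λ x → trans (h∘ι≐⋃ x) (cong (λ Xs → ⋃ Xs x) (map-∘ bs)))

  AlmostPeriodic-compl : AlmostPeriodic (compl D)
  AlmostPeriodic-compl =
    almostPeriodic exponent (not ∘ profile) (cong not ∘ periodic) (∼-compl {D} almost)

Mset-refine : ∀ a₀ b a → a ℕ.≥ a₀ → Σ (List ℤ) λ bs → Increasing bs × AllIn a bs
              × (Mset (2 ^ a₀) b ≐ ⋃ (map (Mset (2 ^ a)) bs))
Mset-refine a₀ b a a≥a₀ with periodic-Mset-normalForm a (Mℤ-periodic b (^-monoʳ-∣ 2 a≥a₀))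
... | bs , inc , allIn , Mℤ∘ι≐⋃ = bs , inc , allIn , λ x → trans (Mset≡Mℤ∘ι _ b x) (Mℤ∘ι≐⋃ x)

Finite⇒InD : ∀ X → Finite X → InD X
Finite⇒InD X X-finite = [] , Finite⇒∼⋃[] {X} X-finite

InD-∼ : ∀ X Y → InD X → X ∼ Y → InD Y
InD-∼ X Y (rs , X∼⋃) X∼Y = rs , ∼-trans {Y} {X} (∼-sym {X} {Y} X∼Y) X∼⋃

InD-compl : ∀ X → InD X → InD (compl X)
InD-compl X X∈𝒟 = AlmostPeriodic⇒InD (AlmostPeriodic-compl (InD⇒AlmostPeriodic {X} X∈𝒟))

InD-⋃ : ∀ Xs → All InD Xs → InD (⋃ Xs)
InD-⋃ []       []                       = [] , [] , λ x ()
InD-⋃ (X ∷ Xs) ((rs , X∼⋃) ∷ Xs-in-D) with InD-⋃ Xs Xs-in-D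
... | rs′ , ⋃Xs∼⋃ = rs ++ rs′ , ∼-≐-trans {⋃ (X ∷ Xs)} (∼-∪ {X} {_} {⋃ Xs} X∼⋃ ⋃Xs∼⋃)
  (λ x → sym (trans (cong (λ Ys → ⋃ Ys x) (map-++ _ rs rs′)) (⋃-++ (map _ rs) (map _ rs′) x)))

norm : Carrier → ℕ
norm (inj₁ n) = n
norm (inj₂ z) = ℤ.∣ z ∣

maxNorm : List Carrier → ℕ
maxNorm []       = 0
maxNorm (x ∷ xs) = norm x ⊔ maxNorm xs

∈⇒norm≤maxNorm : ∀ {x xs} → x ∈ xs → norm x ℕ.≤ maxNorm xs
∈⇒norm≤maxNorm {x} {_ ∷ xs} (here refl) = ℕP.m≤m⊔n (norm x) (maxNorm xs)
∈⇒norm≤maxNorm {x} {y ∷ xs} (there x∈xs) =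
  ℕP.≤-trans (∈⇒norm≤maxNorm x∈xs) (ℕP.m≤n⊔m (norm y) (maxNorm xs))

∼⇒eventually-≡ : ∀ {X Y} → X ∼ Y → Σ ℕ λ K → ∀ x → K ℕ.< norm x → X x ≡ Y x
∼⇒eventually-≡ {X} {Y} (L , X△Y⊆L) = maxNorm L , agree
  where
  agree : ∀ x → maxNorm L ℕ.< norm x → X x ≡ Y x
  agree x K<∣x∣ with X x | Y x | X△Y⊆L x
  ... | true  | true  | _   = refl
  ... | false | false | _   = refl
  ... | true  | false | x∈L = ⊥-elim (ℕP.<⇒≱ K<∣x∣ (∈⇒norm≤maxNorm (x∈L tt)))
  ... | false | true  | x∈L = ⊥-elim (ℕP.<⇒≱ K<∣x∣ (∈⇒norm≤maxNorm (x∈L tt)))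

T⇒≡true : ∀ {b} → T b → b ≡ true
T⇒≡true = Equivalence.to T-≡

≡true⇒T : ∀ {b} → b ≡ true → T b
≡true⇒T = Equivalence.from T-≡

-∣i∣≤i : ∀ i → ℤ.- (+ ℤ.∣ i ∣) ℤ.≤ i
-∣i∣≤i (+ n)    = ℤP.neg-≤-pos
-∣i∣≤i -[1+ n ] = ℤP.≤-refl

periodic-eventually-true : ∀ {p h} .{{_ : ℕ.NonZero p}} → Periodic p h → ∀ K →
                           (∀ n → K ℕ.< n → h (+ n) ≡ true) → ∀ z → h z ≡ true
periodic-eventually-true {p} {h} per K h-true z = begin
  h z                              ≡⟨ periodic-∣ per (p∣z-z%p p z) ⟩
  h (+ r)                          ≡⟨ periodic-+-multiple per (suc K) (+ r) ⟨
  h (+ r ℤ.+ + (suc K ℕ.* p))      ≡⟨ cong h (ℤP.pos-+ r (suc K ℕ.* p)) ⟨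
  h (+ (r ℕ.+ suc K ℕ.* p))        ≡⟨ h-true _ K<r+[1+K]p ⟩
  true                             ∎
  where
  open ≡-Reasoning
  r = z %ℕ p
  K<r+[1+K]p : K ℕ.< r ℕ.+ suc K ℕ.* p
  K<r+[1+K]p = ℕP.≤-trans (ℕP.m≤m*n (suc K) p) (ℕP.m≤n+m _ r)

module _ {D : Subset} (0∈D : 0M ∈ₛ D) (D-closed : ∀ x → x ∈ₛ D → sM x ∈ₛ D) where

  inj₁-∈ : ∀ n → inj₁ n ∈ₛ D
  inj₁-∈ zero    = 0∈D
  inj₁-∈ (suc n) = D-closed (inj₁ n) (inj₁-∈ n)

  inj₂-upward : ∀ j w → inj₂ w ∈ₛ D → inj₂ (w ℤ.+ + j) ∈ₛ D
  inj₂-upward zero    w w∈D = subst (λ v → inj₂ v ∈ₛ D) (sym (ℤP.+-identityʳ w)) w∈D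
  inj₂-upward (suc j) w w∈D = subst (λ v → inj₂ v ∈ₛ D)
    (trans (ℤP.+-assoc w (+ 1) (+ j)) (cong (λ v → w ℤ.+ v) (sym (ℤP.pos-+ 1 j))))
    (inj₂-upward j (w ℤ.+ + 1) (D-closed (inj₂ w) w∈D))

  AlmostPeriodic-induction : AlmostPeriodic D → D ≐ Full
  AlmostPeriodic-induction (almostPeriodic a h per D∼h∘ι) = D-full
    where
    instance _ = ℕP.m^n≢0 2 a
    K = proj₁ (∼⇒eventually-≡ {D} D∼h∘ι)
    agree = proj₂ (∼⇒eventually-≡ {D} D∼h∘ι)
    h-true : ∀ z → h z ≡ true
    h-true = periodic-eventually-true per K λ n K<n → trans (sym (agree (inj₁ n) K<n)) (T⇒≡true (inj₁-∈ n))
    D-full : D ≐ Full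
    D-full (inj₁ n) = T⇒≡true (inj₁-∈ n)
    D-full (inj₂ z) = T⇒≡true (subst (λ v → inj₂ v ∈ₛ D) (i+∣j-i∣≡j w≤z) (inj₂-upward ℤ.∣ z ℤ.- w ∣ w w∈D))
      where
      w = ℤ.- (+ (suc K ℕ.+ ℤ.∣ z ∣))
      w≤z : w ℤ.≤ z
      w≤z = ℤP.≤-trans (ℤP.neg-mono-≤ (ℤ.+≤+ (ℕP.m≤n+m ℤ.∣ z ∣ (suc K)))) (-∣i∣≤i z)
      K<∣w∣ : K ℕ.< ℤ.∣ w ∣
      K<∣w∣ = subst (K ℕ.<_) (sym (ℤP.∣-i∣≡∣i∣ (+ _))) (ℕP.m≤m+n (suc K) ℤ.∣ z ∣)
      w∈D : inj₂ w ∈ₛ D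
      w∈D = ≡true⇒T (trans (agree (inj₂ w) K<∣w∣) (h-true w))

module _ where
  open import Data.Nat using (_+_; _*_; _≤_; _<_)
  open ≡-Reasoning

  infix 4 _≈[_]_

  _≈[_]_ : ℕ → ℕ → ℕ → Set
  m ≈[ e ] n = m ≤ n + e × n ≤ m + e

  ≈-trans : ∀ {m n o e f} → m ≈[ e ] n → n ≈[ f ] o → m ≈[ e + f ] o
  ≈-trans {m} {n} {o} {e} {f} (m≤n+e , n≤m+e) (n≤o+f , o≤n+f) =
    ℕP.≤-trans m≤n+e (ℕP.≤-trans (ℕP.+-monoˡ-≤ e n≤o+f) (ℕP.≤-reflexive (reassoc o f e))) ,
    ℕP.≤-trans o≤n+f (ℕP.≤-trans (ℕP.+-monoˡ-≤ f n≤m+e) (ℕP.≤-reflexive (ℕP.+-assoc m e f)))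
    where
    reassoc : ∀ o f e → o + f + e ≡ o + (e + f)
    reassoc = ℕ-Ring.solve-∀

  ≈-+ : ∀ {m n m′ n′ e f} → m ≈[ e ] n → m′ ≈[ f ] n′ → m + m′ ≈[ e + f ] n + n′
  ≈-+ {m} {n} {m′} {n′} {e} {f} (m≤n+e , n≤m+e) (m′≤n′+f , n′≤m′+f) =
    ℕP.≤-trans (ℕP.+-mono-≤ m≤n+e m′≤n′+f) (ℕP.≤-reflexive (interchange n e n′ f)) ,
    ℕP.≤-trans (ℕP.+-mono-≤ n≤m+e n′≤m′+f) (ℕP.≤-reflexive (interchange m e m′ f))
    where
    interchange : ∀ a b c d → (a + b) + (c + d) ≡ (a + c) + (b + d)
    interchange = ℕ-Ring.solve-∀

  ≈-*ˡ : ∀ c {m n e} → m ≈[ e ] n → c * m ≈[ c * e ] c * n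
  ≈-*ˡ c {m} {n} {e} (m≤n+e , n≤m+e) =
    subst (c * m ≤_) (ℕP.*-distribˡ-+ c n e) (ℕP.*-monoʳ-≤ c m≤n+e) ,
    subst (c * n ≤_) (ℕP.*-distribˡ-+ c m e) (ℕP.*-monoʳ-≤ c n≤m+e)

  ≈-bounded : ∀ {m n e} → m ≤ e → n ≤ e → m ≈[ e ] n
  ≈-bounded {m} {n} {e} m≤e n≤e = ℕP.≤-trans m≤e (ℕP.m≤n+m e n) , ℕP.≤-trans n≤e (ℕP.m≤n+m e m)

  ≡⇒≈ : ∀ {m n} → m ≡ n → m ≈[ 0 ] n
  ≡⇒≈ {m} refl = ℕP.≤-reflexive (sym (ℕP.+-identityʳ m)) , ℕP.≤-reflexive (sym (ℕP.+-identityʳ m))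

  ≈-drop : ∀ {m c n e f} → m + c ≈[ e ] n → c ≤ f → m ≈[ e + f ] n
  ≈-drop {m} {c} {n} {e} {f} (m+c≤n+e , n≤m+c+e) c≤f =
    ℕP.≤-trans (ℕP.m≤m+n m c)
      (ℕP.≤-trans m+c≤n+e (ℕP.≤-trans (ℕP.m≤m+n (n + e) f) (ℕP.≤-reflexive (ℕP.+-assoc n e f)))) ,
    ℕP.≤-trans n≤m+c+e (ℕP.≤-trans (ℕP.+-monoˡ-≤ e (ℕP.+-monoʳ-≤ m c≤f)) (ℕP.≤-reflexive (swap m f e)))
    where
    swap : ∀ m f e → m + f + e ≡ m + (e + f)
    swap = ℕ-Ring.solve-∀

  ≈-from-balance : ∀ {a b c d e} → a + c ≡ b + d → c ≤ e → d ≤ e → a ≈[ e ] b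
  ≈-from-balance {a} {b} {c} {d} {e} a+c≡b+d c≤e d≤e =
    ℕP.≤-trans (ℕP.m≤m+n a c) (ℕP.≤-trans (ℕP.≤-reflexive a+c≡b+d) (ℕP.+-monoʳ-≤ b d≤e)) ,
    ℕP.≤-trans (ℕP.m≤m+n b d) (ℕP.≤-trans (ℕP.≤-reflexive (sym a+c≡b+d)) (ℕP.+-monoʳ-≤ a c≤e))

  χ≤1 : ∀ b → χ b ≤ 1
  χ≤1 true  = ℕP.≤-refl
  χ≤1 false = ℕ.z≤n

  count : (ℤ → Bool) → ℤ → ℕ → ℕ
  count h lo zero    = 0
  count h lo (suc L) = χ (h lo) + count h (lo ℤ.+ + 1) L

  count≤ : ∀ h lo L → count h lo L ≤ L
  count≤ h lo zero    = ℕ.z≤n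
  count≤ h lo (suc L) = ℕP.+-mono-≤ (χ≤1 (h lo)) (count≤ h (lo ℤ.+ + 1) L)

  count-+ : ∀ h lo L L′ → count h lo (L + L′) ≡ count h lo L + count h (lo ℤ.+ + L) L′
  count-+ h lo zero    L′ = cong (λ i → count h i L′) (sym (ℤP.+-identityʳ lo))
  count-+ h lo (suc L) L′ = begin
    χ (h lo) + count h (lo ℤ.+ + 1) (L + L′)
      ≡⟨ cong (λ c → χ (h lo) + c) (count-+ h (lo ℤ.+ + 1) L L′) ⟩
    χ (h lo) + (count h (lo ℤ.+ + 1) L + count h (lo ℤ.+ + 1 ℤ.+ + L) L′)
      ≡⟨ cong (λ i → χ (h lo) + (count h (lo ℤ.+ + 1) L + count h i L′)) (ℤP.+-assoc lo (+ 1) (+ L)) ⟩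
    χ (h lo) + (count h (lo ℤ.+ + 1) L + count h (lo ℤ.+ + suc L) L′)
      ≡⟨ ℕP.+-assoc (χ (h lo)) _ _ ⟨
    count h lo (suc L) + count h (lo ℤ.+ + suc L) L′ ∎

  count-last : ∀ h lo L → count h lo (suc L) ≡ count h lo L + χ (h (lo ℤ.+ + L))
  count-last h lo L = begin
    count h lo (suc L)                           ≡⟨ cong (count h lo) (ℕP.+-comm 1 L) ⟩
    count h lo (L + 1)                           ≡⟨ count-+ h lo L 1 ⟩
    count h lo L + (χ (h (lo ℤ.+ + L)) + 0)      ≡⟨ cong (λ c → count h lo L + c) (ℕP.+-identityʳ _) ⟩
    count h lo L + χ (h (lo ℤ.+ + L))            ∎

  module _ {p : ℕ} {h : ℤ → Bool} (per : Periodic p h) where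

    count-period-step : ∀ lo → count h (lo ℤ.+ + 1) p ≡ count h lo p
    count-period-step lo = ℕP.+-cancelˡ-≡ (χ (h lo)) _ _ (begin
      χ (h lo) + count h (lo ℤ.+ + 1) p        ≡⟨ count-last h lo p ⟩
      count h lo p + χ (h (lo ℤ.+ + p))        ≡⟨ cong (λ b → count h lo p + χ b) (per lo) ⟩
      count h lo p + χ (h lo)                  ≡⟨ ℕP.+-comm (count h lo p) _ ⟩
      χ (h lo) + count h lo p                  ∎)

    count-period-shift : ∀ j lo → count h (lo ℤ.+ + j) p ≡ count h lo p
    count-period-shift zero    lo = cong (λ i → count h i p) (ℤP.+-identityʳ lo)
    count-period-shift (suc j) lo = begin
      count h (lo ℤ.+ + suc j) p           ≡⟨ cong (λ i → count h i p) (ℤP.+-assoc lo (+ 1) (+ j)) ⟨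
      count h (lo ℤ.+ + 1 ℤ.+ + j) p       ≡⟨ count-period-shift j (lo ℤ.+ + 1) ⟩
      count h (lo ℤ.+ + 1) p               ≡⟨ count-period-step lo ⟩
      count h lo p                         ∎

    count-period : ∀ lo → count h lo p ≡ count h (+ 0) p
    count-period (+ m)    = count-period-shift m (+ 0)
    count-period -[1+ m ] = begin
      count h -[1+ m ] p                   ≡⟨ count-period-shift (suc m) -[1+ m ] ⟨
      count h (-[1+ m ] ℤ.+ + suc m) p     ≡⟨ cong (λ i → count h i p) (ℤP.+-inverseˡ (+ suc m)) ⟩
      count h (+ 0) p                      ∎

    count-periods : ∀ q lo → count h lo (q * p) ≡ q * count h (+ 0) p
    count-periods zero    lo = refl
    count-periods (suc q) lo = begin
      count h lo (p + q * p)                            ≡⟨ count-+ h lo p (q * p) ⟩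
      count h lo p + count h (lo ℤ.+ + p) (q * p)       ≡⟨ cong₂ _+_ (count-period lo) (count-periods q _) ⟩
      count h (+ 0) p + q * count h (+ 0) p             ∎

    count-≈ : .{{_ : ℕ.NonZero p}} → ∀ lo L →
              p * count h lo L ≈[ p * p ] count h (+ 0) p * L
    count-≈ lo L = subst₂ (λ a b → a ≈[ p * p ] b) (sym p*count≡) (sym k*L≡)
      (≈-+ (≡⇒≈ (commute p q k)) (≈-bounded pc≤pp kr≤pp))
      where
      k = count h (+ 0) p
      q = L ℕ./ p
      r = L ℕ.% p
      c = count h (lo ℤ.+ + (q * p)) r
      r<p = m%n<n L p
      L≡ : L ≡ q * p + r
      L≡ = trans (m≡m%n+[m/n]*n L p) (ℕP.+-comm r (q * p))
      commute : ∀ p q k → p * (q * k) ≡ k * (q * p)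
      commute = ℕ-Ring.solve-∀
      p*count≡ : p * count h lo L ≡ p * (q * k) + p * c
      p*count≡ = begin
        p * count h lo L                                   ≡⟨ cong (λ l → p * count h lo l) L≡ ⟩
        p * count h lo (q * p + r)                         ≡⟨ cong (p *_) (count-+ h lo (q * p) r) ⟩
        p * (count h lo (q * p) + c)                       ≡⟨ cong (λ m → p * (m + c)) (count-periods q lo) ⟩
        p * (q * k + c)                                    ≡⟨ ℕP.*-distribˡ-+ p (q * k) c ⟩
        p * (q * k) + p * c                                ∎
      k*L≡ : k * L ≡ k * (q * p) + k * r
      k*L≡ = trans (cong (k *_) L≡) (ℕP.*-distribˡ-+ k (q * p) r)
      pc≤pp : p * c ≤ p * p
      pc≤pp = ℕP.*-monoʳ-≤ p (ℕP.≤-trans (count≤ h _ r) (ℕP.<⇒≤ r<p))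
      kr≤pp : k * r ≤ p * p
      kr≤pp = ℕP.*-mono-≤ (count≤ h (+ 0) p) (ℕP.<⇒≤ r<p)

  windowCount≤ : ∀ X n → windowCount X n ≤ 3 * suc n
  windowCount≤ X zero    = ℕP.+-mono-≤ (χ≤1 (X (inj₁ 0))) (ℕP.≤-trans (χ≤1 (X (inj₂ (+ 0)))) (ℕP.n≤1+n 1))
  windowCount≤ X (suc n) = ℕP.≤-trans
    (ℕP.+-mono-≤ (windowCount≤ X n)
      (ℕP.+-mono-≤ (ℕP.+-mono-≤ (χ≤1 (X (inj₁ (suc n)))) (χ≤1 (X (inj₂ (ℤ.- + suc n)))))
                   (χ≤1 (X (inj₂ (+ suc n))))))
    (ℕP.≤-reflexive (step n))
    where
    step : ∀ n → 3 * suc n + 3 ≡ 3 * suc (suc n)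
    step = ℕ-Ring.solve-∀

  module _ {X Y : Subset} {K : ℕ} (agree : ∀ x → K < norm x → X x ≡ Y x) where

    private
      wX = windowCount X
      wY = windowCount Y

    window-balance : ∀ i → wX (K + i) + wY K ≡ wY (K + i) + wX K
    window-balance zero = begin
      wX (K + 0) + wY K  ≡⟨ cong (λ m → wX m + wY K) (ℕP.+-identityʳ K) ⟩
      wX K + wY K        ≡⟨ ℕP.+-comm (wX K) (wY K) ⟩
      wY K + wX K        ≡⟨ cong (λ m → wY m + wX K) (ℕP.+-identityʳ K) ⟨
      wY (K + 0) + wX K  ∎
    window-balance (suc i) = begin
      wX (K + suc i) + wY K        ≡⟨ cong (λ m → wX m + wY K) (ℕP.+-suc K i) ⟩
      wX (K + i) + new X + wY K    ≡⟨ cong (λ c → wX (K + i) + c + wY K) new-agree ⟩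
      wX (K + i) + new Y + wY K    ≡⟨ swap (wX (K + i)) (new Y) (wY K) ⟩
      wX (K + i) + wY K + new Y    ≡⟨ cong (_+ new Y) (window-balance i) ⟩
      wY (K + i) + wX K + new Y    ≡⟨ swap (wY (K + i)) (new Y) (wX K) ⟨
      wY (K + i) + new Y + wX K    ≡⟨ cong (λ m → wY m + wX K) (ℕP.+-suc K i) ⟨
      wY (K + suc i) + wX K        ∎
      where
      m = suc (K + i)
      new : Subset → ℕ
      new Z = χ (Z (inj₁ m)) + χ (Z (inj₂ (ℤ.- + m))) + χ (Z (inj₂ (+ m)))
      K<m : K < m
      K<m = ℕ.s≤s (ℕP.m≤m+n K i)
      new-agree : new X ≡ new Y
      new-agree = cong₂ _+_ (cong₂ _+_ (cong χ (agree _ K<m)) (cong χ (agree _ K<m))) (cong χ (agree _ K<m))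
      swap : ∀ a b c → a + b + c ≡ a + c + b
      swap = ℕ-Ring.solve-∀

    window-≈ : ∀ n → K ≤ n → windowCount X n ≈[ 3 * suc K ] windowCount Y n
    window-≈ n K≤n = subst (λ m → windowCount X m ≈[ 3 * suc K ] windowCount Y m) (ℕP.m+[n∸m]≡n K≤n)
      (≈-from-balance (window-balance (n ℕ.∸ K)) (windowCount≤ Y K) (windowCount≤ X K))

  -- (2,0) is counted once in a window but by both one-sided counts.
  window-∘ι : ∀ h n →
    windowCount (h ∘ ι) n + χ (h (+ 0)) ≡ 2 * count h (+ 0) (suc n) + count h (ℤ.- + n) (suc n)
  window-∘ι h zero    = base (χ (h (+ 0)))
    where
    base : ∀ c → c + c + c ≡ 2 * (c + 0) + (c + 0)
    base = ℕ-Ring.solve-∀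
  window-∘ι h (suc n) = begin
    windowCount (h ∘ ι) n + (A + B + A) + χ (h (+ 0))        ≡⟨ swap (windowCount (h ∘ ι) n) (A + B + A) _ ⟩
    windowCount (h ∘ ι) n + χ (h (+ 0)) + (A + B + A)        ≡⟨ cong (_+ (A + B + A)) (window-∘ι h n) ⟩
    2 * P + Q + (A + B + A)                                   ≡⟨ regroup P Q A B ⟩
    2 * (P + A) + (B + Q)
      ≡⟨ cong₂ (λ P′ Q′ → 2 * P′ + Q′) (count-last h (+ 0) (suc n)) Q-step ⟨
    2 * count h (+ 0) (suc (suc n)) + count h (ℤ.- + suc n) (suc (suc n)) ∎
    where
    A = χ (h (+ suc n))
    B = χ (h (ℤ.- + suc n))
    P = count h (+ 0) (suc n)
    Q = count h (ℤ.- + n) (suc n)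
    swap : ∀ a b c → a + b + c ≡ a + c + b
    swap = ℕ-Ring.solve-∀
    regroup : ∀ P Q A B → 2 * P + Q + (A + B + A) ≡ 2 * (P + A) + (B + Q)
    regroup = ℕ-Ring.solve-∀
    neg-succ : ∀ x → ℤ.- (+ 1 ℤ.+ x) ℤ.+ + 1 ≡ ℤ.- x
    neg-succ = ℤ-Ring.solve-∀
    Q-step : count h (ℤ.- + suc n) (suc (suc n)) ≡ B + Q
    Q-step = cong (λ i → B + count h i (suc n)) (neg-succ (+ n))

  AlmostPeriodic-window-≈ : ∀ {D} (ap : AlmostPeriodic D) → let open AlmostPeriodic ap in
    Σ ℕ λ B → Σ ℕ λ K → ∀ n → K ≤ n →
      2 ^ exponent * windowCount D n ≈[ B ] 3 * (count profile (+ 0) (2 ^ exponent) * suc n)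
  AlmostPeriodic-window-≈ {D} (almostPeriodic a h per D∼h∘ι) = _ , K , λ n K≤n →
    ≈-trans (≈-*ˡ p (window-≈ agree n K≤n)) (≈-drop (periodic-part n) (ℕP.*-monoʳ-≤ p (χ≤1 (h (+ 0)))))
    where
    instance _ = ℕP.m^n≢0 2 a
    p = 2 ^ a
    k = count h (+ 0) p
    K = proj₁ (∼⇒eventually-≡ {D} D∼h∘ι)
    agree = proj₂ (∼⇒eventually-≡ {D} D∼h∘ι)
    periodic-part : ∀ n →
      p * windowCount (h ∘ ι) n + p * χ (h (+ 0)) ≈[ p * p + p * p + p * p ] 3 * (k * suc n)
    periodic-part n = subst₂ (λ u v → u ≈[ p * p + p * p + p * p ] v) (sym lhs) (sym rhs)
      (≈-+ (≈-+ (count-≈ per (+ 0) (suc n)) (count-≈ per (+ 0) (suc n))) (count-≈ per (ℤ.- + n) (suc n)))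
      where
      P = count h (+ 0) (suc n)
      Q = count h (ℤ.- + n) (suc n)
      expand : ∀ p P Q → p * (2 * P + Q) ≡ p * P + p * P + p * Q
      expand = ℕ-Ring.solve-∀
      triple : ∀ t → 3 * t ≡ t + t + t
      triple = ℕ-Ring.solve-∀
      lhs : p * windowCount (h ∘ ι) n + p * χ (h (+ 0)) ≡ p * P + p * P + p * Q
      lhs = trans (sym (ℕP.*-distribˡ-+ p _ _)) (trans (cong (p *_) (window-∘ι h n)) (expand p P Q))
      rhs : 3 * (k * suc n) ≡ k * suc n + k * suc n + k * suc n
      rhs = triple (k * suc n)

module _ where
  open import Data.Rational using (_+_; _*_; _-_; -_; _≤_; _<_; ∣_∣)
  open import Tactic.RingSolver using (solve-∀)

  -- The zero test lets the solver normalise identities containing the constant 1ℚ.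
  ℚ-ring : ACR.AlmostCommutativeRing _ _
  ℚ-ring = ACR.fromCommutativeRing ℚP.+-*-commutativeRing (λ q → dec⇒maybe (0ℚ ℚP.≟ q))

  toℚ : ℕ → ℚ
  toℚ n = + n / 1

  toℚᵘ-toℚ : ∀ n → toℚᵘ (toℚ n) ℚᵘ.≃ ℚᵘ.mkℚᵘ (+ n) 0
  toℚᵘ-toℚ n = ℚP.toℚᵘ-fromℚᵘ (ℚᵘ.mkℚᵘ (+ n) 0)

  toℚ-+ : ∀ m n → toℚ (m ℕ.+ n) ≡ toℚ m + toℚ n
  toℚ-+ m n = ℚP.toℚᵘ-injective (ℚᵘP.≃-trans (toℚᵘ-toℚ (m ℕ.+ n)) (ℚᵘP.≃-trans (ℚᵘ.*≡* (lemma m n))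
    (ℚᵘP.≃-sym (ℚᵘP.≃-trans (ℚP.toℚᵘ-homo-+ (toℚ m) (toℚ n)) (ℚᵘP.+-cong (toℚᵘ-toℚ m) (toℚᵘ-toℚ n))))))
    where
    denominators : ∀ a b → (a ℤ.+ b) ℤ.* + 1 ≡ (a ℤ.* + 1 ℤ.+ b ℤ.* + 1) ℤ.* + 1
    denominators = ℤ-Ring.solve-∀
    lemma : ∀ m n → + (m ℕ.+ n) ℤ.* + 1 ≡ (+ m ℤ.* + 1 ℤ.+ + n ℤ.* + 1) ℤ.* + 1
    lemma m n = trans (cong (ℤ._* + 1) (ℤP.pos-+ m n)) (denominators (+ m) (+ n))

  toℚ-* : ∀ m n → toℚ (m ℕ.* n) ≡ toℚ m * toℚ n
  toℚ-* m n = ℚP.toℚᵘ-injective (ℚᵘP.≃-trans (toℚᵘ-toℚ (m ℕ.* n))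
    (ℚᵘP.≃-trans (ℚᵘ.*≡* (cong (ℤ._* + 1) (ℤP.pos-* m n)))
    (ℚᵘP.≃-sym (ℚᵘP.≃-trans (ℚP.toℚᵘ-homo-* (toℚ m) (toℚ n)) (ℚᵘP.*-cong (toℚᵘ-toℚ m) (toℚᵘ-toℚ n))))))

  toℚ-mono-≤ : ∀ {m n} → m ℕ.≤ n → toℚ m ≤ toℚ n
  toℚ-mono-≤ {m} {n} m≤n = ℚP.toℚᵘ-cancel-≤
    (ℚᵘP.≤-respʳ-≃ (ℚᵘP.≃-sym (toℚᵘ-toℚ n)) (ℚᵘP.≤-respˡ-≃ (ℚᵘP.≃-sym (toℚᵘ-toℚ m))
      (ℚᵘ.*≤* (subst₂ ℤ._≤_ (sym (ℤP.*-identityʳ (+ m))) (sym (ℤP.*-identityʳ (+ n))) (ℤ.+≤+ m≤n)))))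

  toℚ-mono-< : ∀ {m n} → m ℕ.< n → toℚ m < toℚ n
  toℚ-mono-< {m} {n} m<n = ℚP.toℚᵘ-cancel-<
    (ℚᵘP.<-respʳ-≃ (ℚᵘP.≃-sym (toℚᵘ-toℚ n)) (ℚᵘP.<-respˡ-≃ (ℚᵘP.≃-sym (toℚᵘ-toℚ m))
      (ℚᵘ.*<* (subst₂ ℤ._<_ (sym (ℤP.*-identityʳ (+ m))) (sym (ℤP.*-identityʳ (+ n))) (ℤ.+<+ m<n)))))

  toℚ-cancel-< : ∀ {m n} → toℚ m < toℚ n → m ℕ.< n
  toℚ-cancel-< {m} {n} lt with ℚᵘP.<-respʳ-≃ (toℚᵘ-toℚ n) (ℚᵘP.<-respˡ-≃ (toℚᵘ-toℚ m) (ℚP.toℚᵘ-mono-< lt))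
  ... | ℚᵘ.*<* p with subst₂ ℤ._<_ (ℤP.*-identityʳ (+ m)) (ℤP.*-identityʳ (+ n)) p
  ...   | ℤ.+<+ m<n = m<n

  toℚ-nonNeg : ∀ n → 0ℚ ≤ toℚ n
  toℚ-nonNeg n = toℚ-mono-≤ {0} {n} ℕ.z≤n

  x≤x+1 : ∀ x → x ≤ x + 1ℚ
  x≤x+1 x = subst (_≤ x + 1ℚ) (ℚP.+-identityʳ x) (ℚP.+-monoʳ-≤ x (toℚ-nonNeg 1))

  /-*-cancel : ∀ z m .{{_ : ℕ.NonZero m}} → (z / m) * toℚ m ≡ z / 1
  /-*-cancel z (suc m) = ℚP.toℚᵘ-injective (ℚᵘP.≃-trans (ℚP.toℚᵘ-homo-* (z / suc m) (toℚ (suc m)))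
    (ℚᵘP.≃-trans (ℚᵘP.*-cong (ℚP.toℚᵘ-fromℚᵘ (ℚᵘ.mkℚᵘ z m)) (toℚᵘ-toℚ (suc m)))
    (ℚᵘP.≃-trans (ℚᵘ.*≡* eq) (ℚᵘP.≃-sym (ℚP.toℚᵘ-fromℚᵘ (ℚᵘ.mkℚᵘ z 0))))))
    where
    eq : (z ℤ.* + suc m) ℤ.* + 1 ≡ z ℤ.* + suc (m ℕ.* 1)
    eq = trans (ℤP.*-identityʳ _) (cong (λ t → z ℤ.* + suc t) (sym (ℕP.*-identityʳ m)))

  floor-bounds : ∀ x → 0ℚ ≤ x → toℚ ℤ.∣ ℚ.floor x ∣ ≤ x × x < toℚ (suc ℤ.∣ ℚ.floor x ∣)
  floor-bounds x@(mkℚ -[1+ _ ] _ _) 0≤x = ⊥-elim (ℚP.<-irrefl refl (ℚP.≤-<-trans 0≤x (ℚP.negative⁻¹ x)))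
  floor-bounds x@(mkℚ (+ N) d c) _ =
    subst (λ n → toℚ n ≤ x × x < toℚ (suc n)) (sym floor≡) (lower , upper)
    where
    D = suc d
    floor≡ : ℤ.∣ ℚ.floor (mkℚ (+ N) d c) ∣ ≡ N ℕ./ D
    floor≡ = cong ℤ.∣_∣ (div-pos-is-/ℕ (+ N) D)
    lower : toℚ (N ℕ./ D) ≤ mkℚ (+ N) d c
    lower = ℚP.toℚᵘ-cancel-≤ (ℚᵘP.≤-respˡ-≃ (ℚᵘP.≃-sym (toℚᵘ-toℚ (N ℕ./ D)))
      (ℚᵘ.*≤* (subst₂ ℤ._≤_ (ℤP.pos-* (N ℕ./ D) D) (sym (ℤP.*-identityʳ (+ N)))
        (ℤ.+≤+ (m/n*n≤m N D)))))
    upper : mkℚ (+ N) d c < toℚ (suc (N ℕ./ D))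
    upper = ℚP.toℚᵘ-cancel-< (ℚᵘP.<-respʳ-≃ (ℚᵘP.≃-sym (toℚᵘ-toℚ (suc (N ℕ./ D))))
      (ℚᵘ.*<* (subst₂ ℤ._<_ (sym (ℤP.*-identityʳ (+ N))) (ℤP.pos-* (suc (N ℕ./ D)) D)
        (ℤ.+<+ (subst (ℕ._< suc (N ℕ./ D) ℕ.* D) (sym (m≡m%n+[m/n]*n N D))
          (ℕP.+-monoˡ-< ((N ℕ./ D) ℕ.* D) (m%n<n N D)))))))

  archimedean : ∀ ε → 0ℚ < ε → ∀ C → Σ ℕ λ N → toℚ C < ε * toℚ N
  archimedean ε@(mkℚ (+ zero) _ _) 0<ε _ =
    ⊥-elim (ℚP.<-irrefl refl (subst (0ℚ <_) (ℚP.↥p≡0⇒p≡0 ε refl) 0<ε))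
  archimedean ε@(mkℚ -[1+ _ ] _ _) 0<ε _ = ⊥-elim (ℚP.<-irrefl refl (ℚP.<-trans 0<ε (ℚP.negative⁻¹ ε)))
  archimedean ε@(mkℚ (+ suc e) d c) _ C = suc C ℕ.* suc d , (begin-strict
    toℚ C                        <⟨ toℚ-mono-< (ℕP.n<1+n C) ⟩
    toℚ (suc C)                  ≤⟨ toℚ-mono-≤ (ℕP.m≤m*n (suc C) (suc e)) ⟩
    toℚ (suc C ℕ.* suc e)        ≡⟨ ε*denominator (suc C) ⟨
    ε * toℚ (suc C ℕ.* suc d)    ∎)
    where
    open ℚP.≤-Reasoning
    reorder : ∀ (e d m : ℤ) → (e ℤ.* (m ℤ.* d)) ℤ.* + 1 ≡ (m ℤ.* e) ℤ.* (d ℤ.* + 1)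
    reorder = ℤ-Ring.solve-∀
    ε*denominator : ∀ m → ε * toℚ (m ℕ.* suc d) ≡ toℚ (m ℕ.* suc e)
    ε*denominator m = ℚP.toℚᵘ-injective (ℚᵘP.≃-trans (ℚP.toℚᵘ-homo-* ε (toℚ (m ℕ.* suc d)))
      (ℚᵘP.≃-trans (ℚᵘP.*-congˡ {ℚᵘ.mkℚᵘ (+ suc e) d} (toℚᵘ-toℚ (m ℕ.* suc d)))
      (ℚᵘP.≃-trans (ℚᵘ.*≡* eq) (ℚᵘP.≃-sym (toℚᵘ-toℚ (m ℕ.* suc e))))))
      where
      eq : (+ suc e ℤ.* + (m ℕ.* suc d)) ℤ.* + 1 ≡ + (m ℕ.* suc e) ℤ.* + (suc d ℕ.* 1)
      eq = trans (cong (λ t → (+ suc e ℤ.* t) ℤ.* + 1) (ℤP.pos-* m (suc d)))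
           (trans (reorder (+ suc e) (+ suc d) (+ m))
           (cong₂ ℤ._*_ (sym (ℤP.pos-* m (suc e))) (sym (ℤP.pos-* (suc d) 1))))

  ∣∣≤ : ∀ {a e} → a ≤ e → - a ≤ e → ∣ a ∣ ≤ e
  ∣∣≤ {a} {e} a≤e -a≤e with ℚP.∣p∣≡p∨∣p∣≡-p a
  ... | inj₁ ∣a∣≡a  = subst (_≤ e) (sym ∣a∣≡a) a≤e
  ... | inj₂ ∣a∣≡-a = subst (_≤ e) (sym ∣a∣≡-a) -a≤e

  ≤+⇒-≤ : ∀ {a b e} → a ≤ b + e → a - b ≤ e
  ≤+⇒-≤ {a} {b} {e} a≤b+e = subst (a - b ≤_) (cancel b e) (ℚP.+-monoˡ-≤ (- b) a≤b+e)
    where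
    cancel : ∀ b e → b + e - b ≡ e
    cancel = solve-∀ ℚ-ring

  neg-− : ∀ a b → - (a - b) ≡ b - a
  neg-− = solve-∀ ℚ-ring

  ∣-∣-triangle : ∀ a b c → ∣ a - c ∣ ≤ ∣ a - b ∣ + ∣ b - c ∣
  ∣-∣-triangle a b c =
    subst (λ t → ∣ t ∣ ≤ ∣ a - b ∣ + ∣ b - c ∣) (telescope a b c) (ℚP.∣p+q∣≤∣p∣+∣q∣ (a - b) (b - c))
    where
    telescope : ∀ a b c → (a - b) + (b - c) ≡ a - c
    telescope = solve-∀ ℚ-ring

  ∣∣<-by-scaling : ∀ {a T C ε} → 0ℚ ≤ T → ∣ a * T ∣ ≤ C → C < ε * T → ∣ a ∣ < ε
  ∣∣<-by-scaling {a} {T} {C} {ε} 0≤T ∣aT∣≤C C<εT =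
    ℚP.*-cancelʳ-<-nonNeg T (ℚP.≤-<-trans (subst (_≤ C) ∣aT∣≡∣a∣T ∣aT∣≤C) C<εT)
    where
    instance _ = ℚ.nonNegative 0≤T
    ∣aT∣≡∣a∣T : ∣ a * T ∣ ≡ ∣ a ∣ * T
    ∣aT∣≡∣a∣T = trans (ℚP.∣p*q∣≡∣p∣*∣q∣ a T) (cong (∣ a ∣ *_) (ℚP.0≤p⇒∣p∣≡p 0≤T))

  toℚ-≈ : ∀ {m n e} → m ≈[ e ] n → ∣ toℚ m - toℚ n ∣ ≤ toℚ e
  toℚ-≈ {m} {n} {e} (m≤n+e , n≤m+e) = ∣∣≤
    (≤+⇒-≤ (subst (toℚ m ≤_) (toℚ-+ n e) (toℚ-mono-≤ m≤n+e)))
    (subst (_≤ toℚ e) (sym (neg-− (toℚ m) (toℚ n))) (≤+⇒-≤ (subst (toℚ n ≤_) (toℚ-+ m e) (toℚ-mono-≤ n≤m+e))))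

  denom-rounding : ∀ k n x → toℚ n ≤ x → x < toℚ (suc n) →
                   ∣ toℚ (3 ℕ.* (k ℕ.* suc n)) - toℚ k * denom x ∣ ≤ toℚ (3 ℕ.* k)
  denom-rounding k n x n≤x x<n+1 = begin
    ∣ toℚ (3 ℕ.* (k ℕ.* suc n)) - toℚ k * denom x ∣   ≡⟨ cong (λ t → ∣ t - toℚ k * denom x ∣) expand ⟩
    ∣ t3 * (tk * (1ℚ + tn)) - tk * denom x ∣          ≡⟨ cong ∣_∣ (difference t3 tk tn x) ⟩
    ∣ - ((t3 * tk) * (x - tn)) ∣                      ≡⟨ ℚP.∣-p∣≡∣p∣ _ ⟩
    ∣ (t3 * tk) * (x - tn) ∣                          ≡⟨ ℚP.∣p*q∣≡∣p∣*∣q∣ (t3 * tk) (x - tn) ⟩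
    ∣ t3 * tk ∣ * ∣ x - tn ∣                          ≡⟨ cong (_* ∣ x - tn ∣) ∣t3*tk∣≡t3k ⟩
    toℚ (3 ℕ.* k) * ∣ x - tn ∣                        ≤⟨ ℚP.*-monoˡ-≤-nonNeg (toℚ (3 ℕ.* k)) ∣x-n∣≤1 ⟩
    toℚ (3 ℕ.* k) * 1ℚ                                ≡⟨ ℚP.*-identityʳ _ ⟩
    toℚ (3 ℕ.* k)                                     ∎
    where
    open ℚP.≤-Reasoning
    t3 = toℚ 3
    tk = toℚ k
    tn = toℚ n
    instance _ = ℚ.nonNegative (toℚ-nonNeg (3 ℕ.* k))
    ∣t3*tk∣≡t3k : ∣ t3 * tk ∣ ≡ toℚ (3 ℕ.* k)
    ∣t3*tk∣≡t3k = trans (cong ∣_∣ (sym (toℚ-* 3 k))) (ℚP.0≤p⇒∣p∣≡p (toℚ-nonNeg (3 ℕ.* k)))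
    expand : toℚ (3 ℕ.* (k ℕ.* suc n)) ≡ t3 * (tk * (1ℚ + tn))
    expand = trans (toℚ-* 3 (k ℕ.* suc n)) (cong (t3 *_) (trans (toℚ-* k (suc n)) (cong (tk *_) (toℚ-+ 1 n))))
    difference : ∀ t3 tk tn x → t3 * (tk * (1ℚ + tn)) - tk * (t3 * (x + 1ℚ)) ≡ - ((t3 * tk) * (x - tn))
    difference = solve-∀ ℚ-ring
    ∣x-n∣≤1 : ∣ x - tn ∣ ≤ 1ℚ
    ∣x-n∣≤1 = ∣∣≤ (≤+⇒-≤ (subst (x ≤_) (trans (toℚ-+ 1 n) (ℚP.+-comm 1ℚ tn)) (ℚP.<⇒≤ x<n+1)))
      (subst (_≤ 1ℚ) (sym (neg-− x tn)) (≤+⇒-≤ (ℚP.≤-trans n≤x (x≤x+1 x))))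

  ≤-*-≥1 : ∀ {a t} → 0ℚ ≤ a → 1ℚ ≤ t → a ≤ t * a
  ≤-*-≥1 {a} {t} 0≤a 1≤t = subst (_≤ t * a) (ℚP.*-identityˡ a) (ℚP.*-monoʳ-≤-nonNeg a {{ℚ.nonNegative 0≤a}} 1≤t)

  x≤denom*p : ∀ x p → 0ℚ ≤ x → 1ℚ ≤ p → x ≤ denom x * p
  x≤denom*p x p 0≤x 1≤p = begin
    x              ≤⟨ x≤x+1 x ⟩
    x + 1ℚ         ≤⟨ ≤-*-≥1 0≤x+1 (toℚ-mono-≤ {1} {3} (ℕ.s≤s ℕ.z≤n)) ⟩
    denom x        ≤⟨ ≤-*-≥1 (ℚP.≤-trans 0≤x+1 (≤-*-≥1 0≤x+1 (toℚ-mono-≤ {1} {3} (ℕ.s≤s ℕ.z≤n)))) 1≤p ⟩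
    p * denom x    ≡⟨ ℚP.*-comm p (denom x) ⟩
    denom x * p    ∎
    where
    open ℚP.≤-Reasoning
    0≤x+1 = ℚP.≤-trans 0≤x (x≤x+1 x)

  -- Multiplying by 3(x+1)·p clears both denominators; what remains is the integer error of the
  -- estimate plus the error of replacing x by ⌊x⌋.
  scaled-ratio-error : ∀ X p k B x (0≤x : 0ℚ ≤ x) .{{_ : ℕ.NonZero p}} → let n = ℤ.∣ ℚ.floor x ∣ in
    p ℕ.* windowCount X n ≈[ B ] 3 ℕ.* (k ℕ.* suc n) →
    ∣ (ratio X x 0≤x - + k / p) * (denom x * toℚ p) ∣ ≤ toℚ (B ℕ.+ 3 ℕ.* k)
  scaled-ratio-error X p k B x 0≤x estimate = begin
    ∣ (r - q) * (d * toℚ p) ∣                                  ≡⟨ cong ∣_∣ scaled ⟩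
    ∣ toℚ (p ℕ.* W) - toℚ k * d ∣
      ≤⟨ ∣-∣-triangle (toℚ (p ℕ.* W)) (toℚ 3ks) (toℚ k * d) ⟩
    ∣ toℚ (p ℕ.* W) - toℚ 3ks ∣ + ∣ toℚ 3ks - toℚ k * d ∣
      ≤⟨ ℚP.+-mono-≤ (toℚ-≈ estimate) (denom-rounding k n x n≤x x<n+1) ⟩
    toℚ B + toℚ (3 ℕ.* k)                                      ≡⟨ toℚ-+ B (3 ℕ.* k) ⟨
    toℚ (B ℕ.+ 3 ℕ.* k)                                        ∎
    where
    open ℚP.≤-Reasoning
    n = ℤ.∣ ℚ.floor x ∣
    n≤x = proj₁ (floor-bounds x 0≤x)
    x<n+1 = proj₂ (floor-bounds x 0≤x)
    W = windowCount X n
    3ks = 3 ℕ.* (k ℕ.* suc n)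
    d = denom x
    r = ratio X x 0≤x
    q = + k / p
    r*d≡W : r * d ≡ toℚ W
    r*d≡W = trans (ℚP.*-assoc (toℚ W) (ℚ.1/ d) d)
      (trans (cong (toℚ W *_) (ℚP.*-inverseˡ d)) (ℚP.*-identityʳ (toℚ W)))
      where instance _ = denom-nonZero x 0≤x
    distribute : ∀ r q d m → (r - q) * (d * m) ≡ (r * d) * m - (q * m) * d
    distribute = solve-∀ ℚ-ring
    scaled : (r - q) * (d * toℚ p) ≡ toℚ (p ℕ.* W) - toℚ k * d
    scaled = trans (distribute r q d (toℚ p)) (cong₂ (λ u v → u - v * d)
      (trans (cong (_* toℚ p) r*d≡W) (trans (ℚP.*-comm (toℚ W) (toℚ p)) (sym (toℚ-* p W))))
      (/-*-cancel (+ k) p))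

  HasDensity-from-≈ : ∀ X p k B K .{{_ : ℕ.NonZero p}} →
    (∀ n → K ℕ.≤ n → p ℕ.* windowCount X n ≈[ B ] 3 ℕ.* (k ℕ.* suc n)) → HasDensity X (+ k / p)
  HasDensity-from-≈ X p k B K estimate ε 0<ε = K ℕ.+ N₀ , close
    where
    C = B ℕ.+ 3 ℕ.* k
    N₀ = proj₁ (archimedean ε 0<ε C)
    close : ∀ x (0≤x : 0ℚ ≤ x) → toℚ (K ℕ.+ N₀) ≤ x → ∣ ratio X x 0≤x - + k / p ∣ < ε
    close x 0≤x N≤x = ∣∣<-by-scaling (ℚP.≤-trans 0≤x x≤scale)
      (scaled-ratio-error X p k B x 0≤x (estimate n K≤n)) C<ε·scale
      where
      open ℚP.≤-Reasoning
      instance _ = ℚ.nonNegative (ℚP.<⇒≤ 0<ε)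
      n = ℤ.∣ ℚ.floor x ∣
      K≤n : K ℕ.≤ n
      K≤n = ℕP.≤-trans (ℕP.m≤m+n K N₀)
        (ℕP.≤-pred (toℚ-cancel-< (ℚP.≤-<-trans N≤x (proj₂ (floor-bounds x 0≤x)))))
      scale = denom x * toℚ p
      x≤scale : x ≤ scale
      x≤scale = x≤denom*p x (toℚ p) 0≤x (toℚ-mono-≤ (ℕ.>-nonZero⁻¹ p))
      C<ε·scale : toℚ C < ε * scale
      C<ε·scale = begin-strict
        toℚ C         <⟨ proj₂ (archimedean ε 0<ε C) ⟩
        ε * toℚ N₀    ≤⟨ ℚP.*-monoˡ-≤-nonNeg ε (ℚP.≤-trans (toℚ-mono-≤ (ℕP.m≤n+m N₀ K)) N≤x) ⟩
        ε * x         ≤⟨ ℚP.*-monoˡ-≤-nonNeg ε x≤scale ⟩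
        ε * scale     ∎

AlmostPeriodic-density : ∀ {D} → AlmostPeriodic D → Σ ℚ λ q → HasDensity D q × Dyadic q
AlmostPeriodic-density {D} ap@(almostPeriodic a h _ _) with AlmostPeriodic-window-≈ ap
... | B , K , estimate = + k / 2 ^ a , HasDensity-from-≈ D (2 ^ a) k B K estimate , (+ k , a , refl)
  where
  instance _ = ℕP.m^n≢0 2 a
  k = count h (+ 0) (2 ^ a)

lemma6p2 : (a₀ : ℕ) (b : ℤ) (D : Subset) → InD D →
    ((X : Subset) → Finite X → InD X)
  × ((a : ℕ) → a ≥ a₀ → Σ (List ℤ) λ bs → Increasing bs × AllIn a bs
      × (Mset (2 ^ a₀) b ≐ ⋃ (map (Mset (2 ^ a)) bs)))
  × (Σ ℕ λ a → Σ (List ℤ) λ bs → Increasing bs × AllIn a bs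
      × (D ∼ ⋃ (map (Mset (2 ^ a)) bs)))
  × (Σ ℚ λ q → HasDensity D q × Dyadic q)
  × (0M ∈ₛ D → (∀ x → x ∈ₛ D → sM x ∈ₛ D) → D ≐ Full)
  × (((X Y : Subset) → InD X → X ∼ Y → InD Y)
    × ((X : Subset) → InD X → InD (compl X))
    × ((Xs : List Subset) → All InD Xs → InD (⋃ Xs)))
lemma6p2 a₀ b D D∈𝒟 =
  Finite⇒InD , Mset-refine a₀ b , AlmostPeriodic⇒Mset-normalForm ap , AlmostPeriodic-density ap ,
  (λ 0∈D D-closed → AlmostPeriodic-induction 0∈D D-closed ap) , (InD-∼ , InD-compl , InD-⋃)
  where
  ap = InD⇒AlmostPeriodic D∈𝒟
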